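{- Let $N\ge2$. (i) Every solution of $(E_N)$ of size 3 is irreducible. (ii) Every reducible solution of $(E_N)$ of size 4 has an entry equal to $1$ or $-1$.
   Context: For $a_1,\dots,a_n\in\mathbb{Z}/N\mathbb{Z}$ set $M_n(a_1,\dots,a_n)=\begin{pmatrix}a_n&-1\\1&0\end{pmatrix}\cdots\begin{pmatrix}a_1&-1\\1&0\end{pmatrix}$. An $n$-tuple is a solution of $(E_N)$ (of size $n$) if $M_n(a_1,\dots,a_n)=\pm\mathrm{Id}$ over $\mathbb{Z}/N\mathbb{Z}$. The sum of $(a_1,\dots,a_n)$ and $(b_1,\dots,b_m)$ is $(a_1+b_m,a_2,\dots,a_{n-1},a_n+b_1,b_2,\dots,b_{m-1})\in(\mathbb{Z}/N\mathbb{Z})^{n+m-2}$. Two $n$-tuples are equivalent ($\sim$) if one is a cyclic permutation of the other or of its reversal. A solution $(c_1,\dots,c_n)$ with $n\ge3$ is reducible if there exist solutions $(a_1,\dots,a_m)$, $(b_1,\dots,b_l)$ with $m,l\ge3$ and $(c_1,\dots,c_n)\sim(a_1,\dots,a_m)\oplus(b_1,\dots,b_l)$; irreducible otherwise. -}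

module Defs where

open import Data.Nat as ℕ using (ℕ; zero; suc)
open import Data.Integer using (ℤ; +_; _+_; _-_; _*_; -_)
open import Data.Integer.Divisibility using (_∣_)
open import Data.List using (List; []; _∷_; _++_; [_]; reverse; foldl; length)
open import Data.List.Relation.Binary.Pointwise using (Pointwise)
open import Data.Product using (Σ; ∃; ∃-syntax; _×_)
open import Data.Sum using (_⊎_)

-- Elements of ℤ/Nℤ are represented by integers; equality in ℤ/Nℤ is
-- congruence modulo N.
_≡[_]_ : ℤ → ℕ → ℤ → Set
a ≡[ N ] b = (+ N) ∣ (a - b)

record Mat : Set where
  constructor mat
  field
    m11 m12 m21 m22 : ℤ

open Mat public

_⊗_ : Mat → Mat → Mat
mat a b c d ⊗ mat e f g h =
  mat (a * e + b * g) (a * f + b * h) (c * e + d * g) (c * f + d * h)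

Id : Mat
Id = mat (+ 1) (+ 0) (+ 0) (+ 1)

gen : ℤ → Mat
gen a = mat a (- (+ 1)) (+ 1) (+ 0)

-- M_n(a_1,…,a_n) = gen a_n ⋯ gen a_1
Mₙ : List ℤ → Mat
Mₙ = foldl (λ M a → gen a ⊗ M) Id

_≈[_]_ : Mat → ℕ → Mat → Set
A ≈[ N ] B = (m11 A ≡[ N ] m11 B) × (m12 A ≡[ N ] m12 B)
           × (m21 A ≡[ N ] m21 B) × (m22 A ≡[ N ] m22 B)

negId : Mat
negId = mat (- (+ 1)) (+ 0) (+ 0) (- (+ 1))

Solution : ℕ → List ℤ → Set
Solution N a = (Mₙ a ≈[ N ] Id) ⊎ (Mₙ a ≈[ N ] negId)

lastNE : ℤ → List ℤ → ℤ
lastNE x [] = x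
lastNE x (y ∷ ys) = lastNE y ys

initNE : ℤ → List ℤ → List ℤ
initNE x [] = []
initNE x (y ∷ ys) = x ∷ initNE y ys

-- (a_1,…,a_n) ⊕ (b_1,…,b_m)
--   = (a_1 + b_m, a_2, …, a_{n-1}, a_n + b_1, b_2, …, b_{m-1})
-- (only meaningful, and only used, for n, m ≥ 2; other cases arbitrary)
_⊕_ : List ℤ → List ℤ → List ℤ
(a₁ ∷ a₂ ∷ as) ⊕ (b₁ ∷ b₂ ∷ bs) =
  (a₁ + lastNE b₂ bs) ∷ initNE a₂ as ++ (lastNE a₂ as + b₁) ∷ initNE b₂ bs
_ ⊕ _ = []

rotate : List ℤ → List ℤ
rotate [] = []
rotate (x ∷ xs) = xs ++ [ x ]

rotateⁿ : ℕ → List ℤ → List ℤ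
rotateⁿ zero xs = xs
rotateⁿ (suc k) xs = rotate (rotateⁿ k xs)

_≋[_]_ : List ℤ → ℕ → List ℤ → Set
a ≋[ N ] b = Pointwise (λ x y → x ≡[ N ] y) a b

Equiv : ℕ → List ℤ → List ℤ → Set
Equiv N c d = ∃[ k ] ((d ≋[ N ] rotateⁿ k c) ⊎ (d ≋[ N ] rotateⁿ k (reverse c)))

Reducible : ℕ → List ℤ → Set
Reducible N c =
  (3 ℕ.≤ length c) × Solution N c ×
  (∃[ a ] ∃[ b ] ((3 ℕ.≤ length a) × (3 ℕ.≤ length b) ×
                  Solution N a × Solution N b × Equiv N c (a ⊕ b)))

-- A sum of an m-tuple and an l-tuple has m + l − 2 entries, so a sum of two
-- solutions of size ≥ 3 has at least four entries, and one with exactly four is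
-- a sum of a solution of size 3 and another tuple. The (2,2) entry of
-- M₃(a₁,a₂,a₃) is −a₂, so the middle entry of a size-3 solution is ∓1 modulo N;
-- it reappears as an entry of the sum, and having an entry ≡ ±1 is invariant
-- under ∼.

module Submission where

open import Defs
open import Data.Nat using (ℕ; _≤_)
open import Data.Integer using (ℤ; +_; -_)
open import Data.List using (List; length)
open import Data.List.Relation.Unary.Any using (Any)
open import Data.Product using (_×_)
open import Data.Sum using (_⊎_)
open import Relation.Binary.PropositionalEquality using (_≡_)
open import Relation.Nullary using (¬_)

open import Data.Nat as ℕ using (zero; suc; s≤s)
open import Data.Nat.Properties
  using (+-comm; +-mono-≤; +-monoʳ-≤; +-cancelʳ-≤; ≤-antisym; ≤-trans; ≤-reflexive; <⇒≤; <⇒≢)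
import Data.Nat.Tactic.RingSolver as ℕ-Solver
open import Data.Integer using (_+_; _-_; _*_)
open import Data.Integer.Properties using (neg-involutive)
open import Data.Integer.Divisibility using (_∣_)
import Data.Integer.Divisibility.Signed as Signed
open import Data.Integer.Tactic.RingSolver using (solve-∀)
open import Data.List using ([]; _∷_; _++_; [_]; reverse)
open import Data.List.Properties using (length-++; length-reverse)
open import Data.List.Relation.Binary.Pointwise.Properties using (Pointwise-length)
open import Data.List.Relation.Unary.Any using (here; there)
open import Data.List.Relation.Unary.Any.Properties using (lift-resp; ++-comm; reverse⁻)
open import Data.Product using (_,_)
open import Data.Sum as Sum using (inj₁; inj₂)
open import Function using (id; _∘_)
open import Relation.Binary.Definitions using (_Respects_)
open import Relation.Binary.PropositionalEquality
  using (refl; sym; trans; cong; cong₂; subst; module ≡-Reasoning)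
open import Relation.Unary using (Pred)

module _ {N : ℕ} where

  private
    toSigned : ∀ {x} → + N ∣ x → + N Signed.∣ x
    toSigned {x} = Signed.∣ᵤ⇒∣ {+ N} {x}

    fromSigned : ∀ {x} → + N Signed.∣ x → + N ∣ x
    fromSigned {x} = Signed.∣⇒∣ᵤ {+ N} {x}

  ≡[]-neg : ∀ {x y} → x ≡[ N ] y → (- x) ≡[ N ] (- y)
  ≡[]-neg {x} {y} d =
    fromSigned (subst (+ N Signed.∣_) (neg-sub x y) (Signed.∣m⇒∣-m (toSigned d)))
    where
    neg-sub : ∀ x y → - (x - y) ≡ - x - - y
    neg-sub = solve-∀

  ≡[]-sym : ∀ {x y} → x ≡[ N ] y → y ≡[ N ] x
  ≡[]-sym {x} {y} d =
    fromSigned (subst (+ N Signed.∣_) (swap-sub x y) (Signed.∣m⇒∣-m (toSigned d)))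
    where
    swap-sub : ∀ x y → - (x - y) ≡ y - x
    swap-sub = solve-∀

  ≡[]-trans : ∀ {x y z} → x ≡[ N ] y → y ≡[ N ] z → x ≡[ N ] z
  ≡[]-trans {x} {y} {z} d e =
    fromSigned (subst (+ N Signed.∣_) (telescope x y z)
      (Signed.∣m∣n⇒∣m+n (toSigned {x - y} d) (toSigned {y - z} e)))
    where
    telescope : ∀ x y z → (x - y) + (y - z) ≡ x - z
    telescope = solve-∀

IsPlusMinusOne : ℕ → Pred ℤ _
IsPlusMinusOne N x = (x ≡[ N ] (+ 1)) ⊎ (x ≡[ N ] (- (+ 1)))

IsPlusMinusOne-resp : ∀ N → IsPlusMinusOne N Respects _≡[ N ]_
IsPlusMinusOne-resp N {x} {y} x≡y = Sum.map (resp (+ 1)) (resp (- (+ 1)))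
  where
  resp : ∀ t → x ≡[ N ] t → y ≡[ N ] t
  resp t = ≡[]-trans {x = y} {y = x} {z = t} (≡[]-sym {x = x} {y = y} x≡y)

m22-gen⊗ : ∀ a M → m22 (gen a ⊗ M) ≡ m12 M
m22-gen⊗ a (mat _ f _ h) = row f h
  where
  row : ∀ f h → + 1 * f + + 0 * h ≡ f
  row = solve-∀

m12-M₂ : ∀ a₁ a₂ → m12 (Mₙ (a₁ ∷ a₂ ∷ [])) ≡ - a₂
m12-M₂ = entry
  where
  -- the left-hand side is m12 (Mₙ (a₁ ∷ a₂ ∷ [])) unfolded, which the solver cannot do itself
  entry : ∀ a₁ a₂ → a₂ * (a₁ * + 0 + - + 1 * + 1) + - + 1 * (+ 1 * + 0 + + 0 * + 1) ≡ - a₂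
  entry = solve-∀

m22-M₃ : ∀ a₁ a₂ a₃ → m22 (Mₙ (a₁ ∷ a₂ ∷ a₃ ∷ [])) ≡ - a₂
m22-M₃ a₁ a₂ a₃ = trans (m22-gen⊗ a₃ (Mₙ (a₁ ∷ a₂ ∷ []))) (m12-M₂ a₁ a₂)

m22-M₃≡t⇒a₂≡-t : ∀ {N} a₁ a₂ a₃ t → m22 (Mₙ (a₁ ∷ a₂ ∷ a₃ ∷ [])) ≡[ N ] t →
                  a₂ ≡[ N ] (- t)
m22-M₃≡t⇒a₂≡-t {N} a₁ a₂ a₃ t m22≡t = subst (_≡[ N ] (- t)) (neg-involutive a₂)
  (≡[]-neg {x = - a₂} {y = t} (subst (_≡[ N ] t) (m22-M₃ a₁ a₂ a₃) m22≡t))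

size-3-solution-middle : ∀ {N a₁ a₂ a₃} → Solution N (a₁ ∷ a₂ ∷ a₃ ∷ []) →
                         IsPlusMinusOne N a₂
size-3-solution-middle {a₁ = a₁} {a₂} {a₃} (inj₁ (_ , _ , _ , m22≡1)) =
  inj₂ (m22-M₃≡t⇒a₂≡-t a₁ a₂ a₃ (+ 1) m22≡1)
size-3-solution-middle {a₁ = a₁} {a₂} {a₃} (inj₂ (_ , _ , _ , m22≡-1)) =
  inj₁ (m22-M₃≡t⇒a₂≡-t a₁ a₂ a₃ (- (+ 1)) m22≡-1)

module _ {ℓ} {P : Pred ℤ ℓ} where

  Any-rotate⁻ : ∀ xs → Any P (rotate xs) → Any P xs
  Any-rotate⁻ []       = id
  Any-rotate⁻ (x ∷ xs) = ++-comm xs [ x ]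

  Any-rotateⁿ⁻ : ∀ k xs → Any P (rotateⁿ k xs) → Any P xs
  Any-rotateⁿ⁻ zero    xs = id
  Any-rotateⁿ⁻ (suc k) xs = Any-rotateⁿ⁻ k xs ∘ Any-rotate⁻ (rotateⁿ k xs)

  Equiv-Any⁻ : ∀ {N c d} → P Respects _≡[ N ]_ → Equiv N c d → Any P d → Any P c
  Equiv-Any⁻ {c = c} resp (k , inj₁ d≋) = Any-rotateⁿ⁻ k c ∘ lift-resp resp d≋
  Equiv-Any⁻ {c = c} resp (k , inj₂ d≋) =
    reverse⁻ ∘ Any-rotateⁿ⁻ k (reverse c) ∘ lift-resp resp d≋

length-rotate : ∀ xs → length (rotate xs) ≡ length xs
length-rotate []       = refl
length-rotate (x ∷ xs) = trans (length-++ xs) (+-comm (length xs) 1)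

length-rotateⁿ : ∀ k xs → length (rotateⁿ k xs) ≡ length xs
length-rotateⁿ zero    xs = refl
length-rotateⁿ (suc k) xs = trans (length-rotate (rotateⁿ k xs)) (length-rotateⁿ k xs)

Equiv-length : ∀ {N c d} → Equiv N c d → length d ≡ length c
Equiv-length {c = c} (k , inj₁ d≋) = trans (Pointwise-length d≋) (length-rotateⁿ k c)
Equiv-length {c = c} (k , inj₂ d≋) =
  trans (Pointwise-length d≋) (trans (length-rotateⁿ k (reverse c)) (length-reverse c))

length-initNE : ∀ x xs → length (initNE x xs) ≡ length xs
length-initNE x []       = refl
length-initNE x (y ∷ ys) = cong suc (length-initNE y ys)

length-⊕ : ∀ {a b} → 2 ≤ length a → 2 ≤ length b →
           length (a ⊕ b) ℕ.+ 2 ≡ length a ℕ.+ length b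
length-⊕ {[]}              ()
length-⊕ {_ ∷ []}          (s≤s ())
length-⊕ {_ ∷ _ ∷ _} {[]}     _ ()
length-⊕ {_ ∷ _ ∷ _} {_ ∷ []} _ (s≤s ())
length-⊕ {a₁ ∷ a₂ ∷ as} {b₁ ∷ b₂ ∷ bs} _ _ = begin
  suc (length (initNE a₂ as ++ (lastNE a₂ as + b₁) ∷ initNE b₂ bs)) ℕ.+ 2
    ≡⟨ cong (λ n → suc n ℕ.+ 2) (length-++ (initNE a₂ as)) ⟩
  suc (length (initNE a₂ as) ℕ.+ suc (length (initNE b₂ bs))) ℕ.+ 2
    ≡⟨ cong₂ (λ m n → suc (m ℕ.+ suc n) ℕ.+ 2) (length-initNE a₂ as) (length-initNE b₂ bs) ⟩
  suc (length as ℕ.+ suc (length bs)) ℕ.+ 2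
    ≡⟨ regroup (length as) (length bs) ⟩
  suc (suc (length as)) ℕ.+ suc (suc (length bs)) ∎
  where
  open ≡-Reasoning
  regroup : ∀ m n → suc (m ℕ.+ suc n) ℕ.+ 2 ≡ suc (suc m) ℕ.+ suc (suc n)
  regroup = ℕ-Solver.solve-∀

length-of-sum : ∀ {N c a b} → 3 ≤ length a → 3 ≤ length b → Equiv N c (a ⊕ b) →
                length c ℕ.+ 2 ≡ length a ℕ.+ length b
length-of-sum {N} {a = a} {b} 3≤∣a∣ 3≤∣b∣ c∼a⊕b =
  trans (cong (ℕ._+ 2) (sym (Equiv-length {N} c∼a⊕b)))
        (length-⊕ {a} {b} (<⇒≤ 3≤∣a∣) (<⇒≤ 3≤∣b∣))

6≡m+n⇒m≡3 : ∀ {m n} → 3 ≤ m → 3 ≤ n → 6 ≡ m ℕ.+ n → m ≡ 3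
6≡m+n⇒m≡3 {m} 3≤m 3≤n 6≡m+n =
  ≤-antisym (+-cancelʳ-≤ 3 m 3 (≤-trans (+-monoʳ-≤ m 3≤n) (≤-reflexive (sym 6≡m+n)))) 3≤m

⊕-size-3-solution : ∀ {N a b} → length a ≡ 3 → 2 ≤ length b → Solution N a →
                    Any (IsPlusMinusOne N) (a ⊕ b)
⊕-size-3-solution {a = []}                ()
⊕-size-3-solution {a = _ ∷ []}            ()
⊕-size-3-solution {a = _ ∷ _ ∷ []}        ()
⊕-size-3-solution {a = _ ∷ _ ∷ _ ∷ _ ∷ _} ()
⊕-size-3-solution {a = _ ∷ _ ∷ _ ∷ []} {[]}     refl ()
⊕-size-3-solution {a = _ ∷ _ ∷ _ ∷ []} {_ ∷ []} refl (s≤s ())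
⊕-size-3-solution {a = a₁ ∷ a₂ ∷ a₃ ∷ []} {_ ∷ _ ∷ _} refl _ a-solution =
  there (here (size-3-solution-middle {a₁ = a₁} {a₂} {a₃} a-solution))

size-3-irreducible : ∀ {N c} → length c ≡ 3 → ¬ Reducible N c
size-3-irreducible {N} ∣c∣≡3 (_ , _ , _ , _ , 3≤∣a∣ , 3≤∣b∣ , _ , _ , c∼a⊕b) =
  <⇒≢ (+-mono-≤ 3≤∣a∣ 3≤∣b∣)
    (trans (cong (ℕ._+ 2) (sym ∣c∣≡3)) (length-of-sum {N} 3≤∣a∣ 3≤∣b∣ c∼a⊕b))

size-4-reducible-has-±1 : ∀ {N c} → length c ≡ 4 → Reducible N c →
                          Any (IsPlusMinusOne N) c
size-4-reducible-has-±1 {N} ∣c∣≡4 (_ , _ , a , _ , 3≤∣a∣ , 3≤∣b∣ , a-solution , _ , c∼a⊕b) =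
  Equiv-Any⁻ (λ {x} {y} → IsPlusMinusOne-resp N {x} {y}) c∼a⊕b
    (⊕-size-3-solution ∣a∣≡3 (<⇒≤ 3≤∣b∣) a-solution)
  where
  ∣a∣≡3 : length a ≡ 3
  ∣a∣≡3 = 6≡m+n⇒m≡3 3≤∣a∣ 3≤∣b∣
    (trans (cong (ℕ._+ 2) (sym ∣c∣≡4)) (length-of-sum {N} 3≤∣a∣ 3≤∣b∣ c∼a⊕b))

proposition3p4 : (N : ℕ) → 2 ≤ N →
    ((c : List ℤ) → Solution N c → length c ≡ 3 → ¬ Reducible N c)
    × ((c : List ℤ) → length c ≡ 4 → Reducible N c →
        Any (λ x → (x ≡[ N ] (+ 1)) ⊎ (x ≡[ N ] (- (+ 1)))) c)
proposition3p4 N _ = (λ _ _ → size-3-irreducible) , (λ _ → size-4-reducible-has-±1)
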